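{- Let $p$ be a prime, $D$ a finite set of positive integers, and $U$ a solution of length $\ell$ and weight $w$. Then: (i) the support $\varphi_U$ is a support map of length $\ell$ with $s$ jumps for some $s\leq w$; moreover $\varphi_U$ is irreducible if and only if $U$ is irreducible; (ii) if $\varphi_U$ has $s$ jumps, then $\max_i\varphi_U(i)\leq \frac{w-s+1}{p-1}\max D$; (iii) if $\varphi_U$ has exactly $w$ jumps, then all its jumps are elements of $D$, and $U$ is completely determined by its support (i.e. any solution of length $\ell$ with the same support $\varphi_U$ having $w$ jumps, where $w$ is its weight, equals $U$).
   Context: For $\ell\geq 1$, a solution of length $\ell$ is a tuple $U=(u_d)_{d\in D}$ with $0\leq u_d\leq p^\ell-1$, $\sum_{d\in D}du_d\equiv 0 \pmod{p^\ell-1}$ and $\sum_{d\in D}du_d>0$. Its weight is $\sum_d s_p(u_d)$, where $s_p(n)$ is the sum of the base-$p$ digits of $n$. The shift is the map of $\{0,\dots,p^\ell-1\}$ fixing $p^\ell-1$ and sending other $j$ to $pj \bmod (p^\ell-1)$. The support of $U$ is $\varphi_U:\mathbb{Z}/\ell\mathbb{Z}\to\mathbb{Z}_{>0}$, $\varphi_U(k)=\frac{1}{p^\ell-1}\sum_d d\,\mathrm{shift}^k(u_d)$; $U$ is irreducible if $\varphi_U$ is injective. A map $\varphi:\mathbb{Z}/\ell\mathbb{Z}\to\mathbb{Z}_{>0}$ is a support map of length $\ell$ with $s$ jumps if $\varphi(i+1)=p\varphi(i)$ for all $i$ except exactly $s$ distinct values $i_1,\dots,i_s$, for which $\varphi(i+1)<p\varphi(i)$;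 its jumps are the integers $p\varphi(i_t)-\varphi(i_t+1)$; it is irreducible if injective. -}

module Defs where

open import Data.Nat using (ℕ; zero; suc; _+_; _*_; _∸_; _^_; _≤_; _<_; _⊔_; _<?_)
open import Data.Nat.DivMod using (_/_; _%_)
open import Data.Nat.Divisibility using (_∣_)
open import Data.Nat.Primality using (Prime)
open import Data.Fin using (Fin; zero; suc; toℕ)
open import Data.Nat.ListAction using (sum)
open import Data.List using (List; map; allFin; filter; length; foldr)
open import Data.Product using (_×_; Σ; ∃)
open import Data.Sum using (_⊎_)
open import Relation.Binary.PropositionalEquality using (_≡_)
open import Relation.Nullary using (Dec; yes; no)
open import Data.Nat using (_≟_)
open import Function.Definitions using (Injective)

-- Total versions of division / remainder (value irrelevant when divisor is 0).
divℕ : ℕ → ℕ → ℕ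
divℕ m zero = zero
divℕ m (suc k) = m / suc k

modℕ : ℕ → ℕ → ℕ
modℕ m zero = m
modℕ m (suc k) = m % suc k

-- Sum of base-p digits, s_p(n), computed with fuel (fuel n suffices when p ≥ 2).
digitSumAux : ℕ → ℕ → ℕ → ℕ
digitSumAux p zero n = zero
digitSumAux p (suc fuel) n = modℕ n p + digitSumAux p fuel (divℕ n p)

digitSum : ℕ → ℕ → ℕ
digitSum p n = digitSumAux p n n

Σ[_] : ∀ {n} → (Fin n → ℕ) → ℕ
Σ[_] {n} f = sum (map f (allFin n))

-- max D (0 if D is empty)
maxF : ∀ {n} → (Fin n → ℕ) → ℕ
maxF {n} f = foldr _⊔_ zero (map f (allFin n))

-- i ↦ i + 1 in ℤ/ℓℤ, with ℤ/ℓℤ represented by Fin ℓ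
next : ∀ {ℓ} → Fin ℓ → Fin ℓ
next {suc zero} zero = zero
next {suc (suc m)} zero = suc zero
next {suc (suc m)} (suc i) with next {suc m} i
... | zero = zero
... | suc j = suc (suc j)

iter : {A : Set} → ℕ → (A → A) → A → A
iter zero f x = x
iter (suc k) f x = f (iter k f x)

Mod : ℕ → ℕ → ℕ
Mod p ℓ = p ^ ℓ ∸ 1

shift : (p ℓ : ℕ) → ℕ → ℕ
shift p ℓ j with j ≟ Mod p ℓ
... | yes _ = j
... | no _ = modℕ (p * j) (Mod p ℓ)

-- D is a finite set of positive integers, given as an injective family D : Fin n → ℕ.
-- A tuple U = (u_d)_{d∈D} is a family U : Fin n → ℕ (u_{D j} = U j).
IsSolution : (p : ℕ) {n : ℕ} (D : Fin n → ℕ) (ℓ : ℕ) (U : Fin n → ℕ) → Set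
IsSolution p D ℓ U =
  1 ≤ ℓ
  × (∀ j → U j ≤ Mod p ℓ)
  × (Mod p ℓ ∣ Σ[ (λ j → D j * U j) ])
  × (0 < Σ[ (λ j → D j * U j) ])

weight : (p : ℕ) {n : ℕ} → (Fin n → ℕ) → ℕ
weight p U = Σ[ (λ j → digitSum p (U j)) ]

support : (p : ℕ) {n : ℕ} (D : Fin n → ℕ) (ℓ : ℕ) (U : Fin n → ℕ) → Fin ℓ → ℕ
support p D ℓ U k =
  divℕ (Σ[ (λ j → D j * iter (toℕ k) (shift p ℓ) (U j)) ]) (Mod p ℓ)

jumpPositions : (p : ℕ) {ℓ : ℕ} → (Fin ℓ → ℕ) → List (Fin ℓ)
jumpPositions p {ℓ} φ = filter (λ i → φ (next i) <? p * φ i) (allFin ℓ)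

IsSupportMap : (p : ℕ) {ℓ : ℕ} → (Fin ℓ → ℕ) → ℕ → Set
IsSupportMap p {ℓ} φ s =
  (∀ i → 0 < φ i)
  × (∀ i → φ (next i) ≡ p * φ i ⊎ φ (next i) < p * φ i)
  × length (jumpPositions p φ) ≡ s

jumpAt : (p : ℕ) {ℓ : ℕ} → (Fin ℓ → ℕ) → Fin ℓ → ℕ
jumpAt p φ i = p * φ i ∸ φ (next i)

IrreducibleMap : {ℓ : ℕ} → (Fin ℓ → ℕ) → Set
IrreducibleMap φ = Injective _≡_ _≡_ φ

IrreducibleSol : (p : ℕ) {n : ℕ} (D : Fin n → ℕ) (ℓ : ℕ) (U : Fin n → ℕ) → Set
IrreducibleSol p D ℓ U = IrreducibleMap (support p D ℓ U)

-- Put M = p ^ ℓ ∸ 1. For x ≤ M we have p · x = shift x + M · carry x, and the carries met along the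
-- shift orbit of u are the ℓ base-p digits of u, so s_p(u) is their sum. Weighting by d ∈ D and summing
-- gives p · φ(k) = φ(k + 1) + C(k), where C(k) = Σ_d d · (k-th digit of u_d): the jumps of φ sit exactly
-- where the digit column k is nonzero, hence there are at most w of them, and the jump there is C(k).
-- Telescoping over one period gives M · φ(a) = Σ_t C(a + t) p^(ℓ-1-t) ≤ max D · Σ_t W(a + t) p^(ℓ-1-t),
-- W(k) being the digit sum of column k, and a numeral with digit sum w and s nonzero digits is at most
-- (w − s + 1)(p^ℓ − 1)/(p − 1); this is (ii). When s = w every nonzero column is a single digit 1, so each
-- jump C(k) is an element of D, and injectivity of D recovers every column, hence every u_d, from φ.

module Submission where

open import Defs
open import Data.Nat
open import Data.Nat.Properties
open import Data.Nat.DivMod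
open import Data.Nat.Divisibility using (_∣_; ∣m+n∣m⇒∣n; ∣n⇒∣m*n; m∣m*n)
open import Data.Nat.ListAction using (sum)
open import Data.Nat.Primality using (Prime)
open import Data.Nat.Tactic.RingSolver using (solve-∀)
open import Algebra.Properties.Semiring.Sum +-*-semiring
  using (sum-cong-≗; ∑-distrib-+; *-distribˡ-sum; sum-replicate-zero) renaming (sum to ∑)
open import Data.Fin using (Fin; zero; suc; toℕ; fromℕ<) renaming (_≟_ to _≟ᶠ_)
open import Data.Fin.Properties using (toℕ-fromℕ<; toℕ<n) renaming (suc-injective to suc-injectiveᶠ)
open import Data.List using ([]; _∷_; map; filter; length; foldr; allFin)
open import Data.List.Properties using (map-tabulate)
open import Data.Product using (_×_; _,_; proj₁; proj₂; ∃)
open import Data.Sum using (_⊎_; inj₁; inj₂)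
open import Data.Empty using (⊥-elim)
open import Function using (_∘_; id; const)
open import Function.Bundles using (_⇔_; mk⇔)
open import Function.Definitions using (Injective)
open import Level using (0ℓ)
open import Relation.Binary.PropositionalEquality
open import Relation.Nullary using (yes; no; contradiction)
open import Relation.Unary using (Pred; Decidable)

modℕ≡% : ∀ m k .{{_ : NonZero k}} → modℕ m k ≡ m % k
modℕ≡% m (suc k) = refl

divℕ≡/ : ∀ m k .{{_ : NonZero k}} → divℕ m k ≡ m / k
divℕ≡/ m (suc k) = refl

remainder-quotient-unique : ∀ k .{{_ : NonZero k}} {a b a′ b′} → a < k → a′ < k →
  a + k * b ≡ a′ + k * b′ → a ≡ a′ × b ≡ b′
remainder-quotient-unique k {a} {b} {a′} {b′} a<k a′<k eq = a≡a′ , b≡b′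
  where
  remainder : ∀ {x} y → x < k → (x + k * y) % k ≡ x
  remainder {x} y x<k = trans (cong (λ z → (x + z) % k) (*-comm k y))
                              (trans ([m+kn]%n≡m%n x y k) (m<n⇒m%n≡m x<k))
  a≡a′ : a ≡ a′
  a≡a′ = trans (sym (remainder b a<k)) (trans (cong (_% k) eq) (remainder b′ a′<k))
  b≡b′ : b ≡ b′
  b≡b′ = *-cancelˡ-≡ b b′ k (+-cancelˡ-≡ a _ _ (trans eq (cong (_+ k * b′) (sym a≡a′))))

%-/-unique : ∀ m k .{{_ : NonZero k}} {a b} → a < k → m ≡ a + k * b → m % k ≡ a × m / k ≡ b
%-/-unique m k a<k m≡ = remainder-quotient-unique k (m%n<n m k) a<k (begin
  m % k + k * (m / k) ≡⟨ cong (m % k +_) (*-comm k (m / k)) ⟩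
  m % k + m / k * k   ≡⟨ sym (m≡m%n+[m/n]*n m k) ⟩
  m                   ≡⟨ m≡ ⟩
  _                   ∎)
  where open ≡-Reasoning

iter-+ : ∀ {A : Set} k m (f : A → A) x → iter (k + m) f x ≡ iter k f (iter m f x)
iter-+ zero    m f x = refl
iter-+ (suc k) m f x = cong f (iter-+ k m f x)

Σ-suc : ∀ {n} (f : Fin (suc n) → ℕ) → Σ[ f ] ≡ f zero + Σ[ f ∘ suc ]
Σ-suc {n} f = cong (λ xs → f zero + sum xs)
  (trans (map-tabulate suc f) (sym (map-tabulate id (f ∘ suc))))

Σ≡∑ : ∀ {n} (f : Fin n → ℕ) → Σ[ f ] ≡ ∑ f
Σ≡∑ {zero}  f = refl
Σ≡∑ {suc n} f = trans (Σ-suc f) (cong (f zero +_) (Σ≡∑ (f ∘ suc)))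

Σ-cong : ∀ {n} {f g : Fin n → ℕ} → (∀ j → f j ≡ g j) → Σ[ f ] ≡ Σ[ g ]
Σ-cong {f = f} {g} f≗g = trans (Σ≡∑ f) (trans (sum-cong-≗ f≗g) (sym (Σ≡∑ g)))

Σ-distrib-+ : ∀ {n} (f g : Fin n → ℕ) → Σ[ (λ j → f j + g j) ] ≡ Σ[ f ] + Σ[ g ]
Σ-distrib-+ f g = trans (Σ≡∑ (λ j → f j + g j)) (trans (∑-distrib-+ f g) (sym (cong₂ _+_ (Σ≡∑ f) (Σ≡∑ g))))

*-distribˡ-Σ : ∀ {n} a (f : Fin n → ℕ) → a * Σ[ f ] ≡ Σ[ (λ j → a * f j) ]
*-distribˡ-Σ a f = trans (cong (a *_) (Σ≡∑ f)) (trans (*-distribˡ-sum a f) (sym (Σ≡∑ (λ j → a * f j))))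

Σ-zero : ∀ {n} {f : Fin n → ℕ} → (∀ j → f j ≡ 0) → Σ[ f ] ≡ 0
Σ-zero {n} f≗0 = trans (Σ-cong f≗0) (trans (Σ≡∑ {n} (λ _ → 0)) (sum-replicate-zero n))

Σ-mono-≤ : ∀ {n} {f g : Fin n → ℕ} → (∀ j → f j ≤ g j) → Σ[ f ] ≤ Σ[ g ]
Σ-mono-≤ {zero}          f≤g = z≤n
Σ-mono-≤ {suc n} {f} {g} f≤g = subst₂ _≤_ (sym (Σ-suc f)) (sym (Σ-suc g))
  (+-mono-≤ (f≤g zero) (Σ-mono-≤ (f≤g ∘ suc)))

Σ≡0⇒≡0 : ∀ {n} (f : Fin n → ℕ) → Σ[ f ] ≡ 0 → ∀ j → f j ≡ 0
Σ≡0⇒≡0 f Σf≡0 zero    = m+n≡0⇒m≡0 (f zero) (trans (sym (Σ-suc f)) Σf≡0)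
Σ≡0⇒≡0 f Σf≡0 (suc j) = Σ≡0⇒≡0 (f ∘ suc) (m+n≡0⇒n≡0 (f zero) (trans (sym (Σ-suc f)) Σf≡0)) j

maxF-suc : ∀ {n} (f : Fin (suc n) → ℕ) → maxF f ≡ f zero ⊔ maxF (f ∘ suc)
maxF-suc {n} f = cong (λ xs → f zero ⊔ foldr _⊔_ 0 xs)
  (trans (map-tabulate suc f) (sym (map-tabulate id (f ∘ suc))))

≤-maxF : ∀ {n} (f : Fin n → ℕ) j → f j ≤ maxF f
≤-maxF f zero    = subst (f zero ≤_) (sym (maxF-suc f)) (m≤m⊔n _ _)
≤-maxF f (suc j) = subst (f (suc j) ≤_) (sym (maxF-suc f)) (≤-trans (≤-maxF (f ∘ suc) j) (m≤n⊔m _ _))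

Σ≤Σ-weighted : ∀ {n} (D f : Fin n → ℕ) → (∀ j → 0 < D j) → Σ[ f ] ≤ Σ[ (λ j → D j * f j) ]
Σ≤Σ-weighted D f D>0 = Σ-mono-≤ (λ j → subst (_≤ D j * f j) (*-identityˡ (f j)) (*-monoˡ-≤ (f j) (D>0 j)))

Σ-weighted≤max : ∀ {n} (D f : Fin n → ℕ) → Σ[ (λ j → D j * f j) ] ≤ maxF D * Σ[ f ]
Σ-weighted≤max D f = subst (Σ[ (λ j → D j * f j) ] ≤_) (sym (*-distribˡ-Σ (maxF D) f)) (Σ-mono-≤ (λ j → *-monoˡ-≤ (f j) (≤-maxF D j)))

IsUnitVector : ∀ {n} → (Fin n → ℕ) → Fin n → Set
IsUnitVector f j = f j ≡ 1 × (∀ i → i ≢ j → f i ≡ 0)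

Σ≤1⇒zero⊎unitVector : ∀ {n} (f : Fin n → ℕ) → Σ[ f ] ≤ 1 → (∀ j → f j ≡ 0) ⊎ ∃ (IsUnitVector f)
Σ≤1⇒zero⊎unitVector {zero}  f _ = inj₁ (λ ())
Σ≤1⇒zero⊎unitVector {suc n} f Σf≤1 with f zero in f₀ | subst (_≤ 1) (Σ-suc f) Σf≤1
... | zero | rest≤1 with Σ≤1⇒zero⊎unitVector (f ∘ suc) rest≤1
...   | inj₁ rest≡0 = inj₁ λ { zero → f₀ ; (suc j) → rest≡0 j }
...   | inj₂ (j , fj≡1 , others) =
  inj₂ (suc j , fj≡1 , λ { zero _ → f₀ ; (suc i) i≢j → others i (i≢j ∘ cong suc) })
Σ≤1⇒zero⊎unitVector {suc n} f Σf≤1 | suc k | s≤s k+rest≤0 =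
  inj₂ (zero , trans f₀ (cong suc (m+n≡0⇒m≡0 k k+rest≡0)) ,
        λ { zero 0≢0 → ⊥-elim (0≢0 refl) ; (suc i) _ → Σ≡0⇒≡0 (f ∘ suc) (m+n≡0⇒n≡0 k k+rest≡0) i })
  where k+rest≡0 = n≤0⇒n≡0 k+rest≤0

Σ-*-unitVector : ∀ {n} (g f : Fin n → ℕ) {j} → IsUnitVector f j → Σ[ (λ i → g i * f i) ] ≡ g j
Σ-*-unitVector {suc n} g f {zero} (f₀≡1 , others) = begin
  Σ[ (λ i → g i * f i) ]                         ≡⟨ Σ-suc (λ i → g i * f i) ⟩
  g zero * f zero + Σ[ (λ i → g (suc i) * f (suc i)) ]
    ≡⟨ cong₂ _+_ (trans (cong (g zero *_) f₀≡1) (*-identityʳ (g zero)))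
                 (Σ-zero (λ i → trans (cong (g (suc i) *_) (others (suc i) λ ())) (*-zeroʳ (g (suc i))))) ⟩
  g zero + 0                                     ≡⟨ +-identityʳ (g zero) ⟩
  g zero                                         ∎
  where open ≡-Reasoning
Σ-*-unitVector {suc n} g f {suc j} (fj≡1 , others) = begin
  Σ[ (λ i → g i * f i) ]                         ≡⟨ Σ-suc (λ i → g i * f i) ⟩
  g zero * f zero + Σ[ (λ i → g (suc i) * f (suc i)) ]
    ≡⟨ cong₂ _+_ (trans (cong (g zero *_) (others zero λ ())) (*-zeroʳ (g zero)))
                 (Σ-*-unitVector (g ∘ suc) (f ∘ suc) (fj≡1 , λ i i≢j → others (suc i) (i≢j ∘ suc-injectiveᶠ))) ⟩
  g (suc j)                                      ∎
  where open ≡-Reasoning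

unitVector-unique : ∀ {n} {f g : Fin n → ℕ} {j} → IsUnitVector f j → IsUnitVector g j → ∀ i → f i ≡ g i
unitVector-unique {j = j} (fj≡1 , f-others) (gj≡1 , g-others) i with i ≟ᶠ j
... | yes refl = trans fj≡1 (sym gj≡1)
... | no i≢j   = trans (f-others i i≢j) (sym (g-others i i≢j))

Σ-*-zero : ∀ {n} (D f : Fin n → ℕ) → (∀ j → f j ≡ 0) → Σ[ (λ j → D j * f j) ] ≡ 0
Σ-*-zero D f f≡0 = Σ-zero (λ j → trans (cong (D j *_) (f≡0 j)) (*-zeroʳ (D j)))

Σ≤1⇒weighted-Σ≡weight : ∀ {n} (D f : Fin n → ℕ) → Σ[ f ] ≤ 1 → 0 < Σ[ (λ j → D j * f j) ] →
  ∃ λ j → Σ[ (λ i → D i * f i) ] ≡ D j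
Σ≤1⇒weighted-Σ≡weight D f Σf≤1 pos with Σ≤1⇒zero⊎unitVector f Σf≤1
... | inj₁ f≡0     = ⊥-elim (<-irrefl (sym (Σ-*-zero D f f≡0)) pos)
... | inj₂ (j , u) = j , Σ-*-unitVector D f u

weighted-Σ-injective : ∀ {n} (D : Fin n → ℕ) → Injective _≡_ _≡_ D → (∀ j → 0 < D j) →
  ∀ {f g} → Σ[ f ] ≤ 1 → Σ[ g ] ≤ 1 →
  Σ[ (λ j → D j * f j) ] ≡ Σ[ (λ j → D j * g j) ] → ∀ j → f j ≡ g j
weighted-Σ-injective D D-inj D>0 {f} {g} Σf≤1 Σg≤1 eq
  with Σ≤1⇒zero⊎unitVector f Σf≤1 | Σ≤1⇒zero⊎unitVector g Σg≤1
... | inj₁ f≡0 | inj₁ g≡0 = λ j → trans (f≡0 j) (sym (g≡0 j))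
... | inj₁ f≡0 | inj₂ (j , u) =
  ⊥-elim (<-irrefl (trans (sym (Σ-*-zero D f f≡0)) (trans eq (Σ-*-unitVector D g u))) (D>0 j))
... | inj₂ (j , u) | inj₁ g≡0 =
  ⊥-elim (<-irrefl (trans (sym (Σ-*-zero D g g≡0)) (trans (sym eq) (Σ-*-unitVector D f u))) (D>0 j))
... | inj₂ (j , u) | inj₂ (j′ , u′) with D-inj (trans (sym (Σ-*-unitVector D f u)) (trans eq (Σ-*-unitVector D g u′)))
...   | refl = unitVector-unique u u′

sum< : (ℕ → ℕ) → ℕ → ℕ
sum< g zero    = 0
sum< g (suc m) = g 0 + sum< (g ∘ suc) m

sum<-snoc : ∀ g m → sum< g (suc m) ≡ sum< g m + g m
sum<-snoc g zero    = +-comm (g 0) 0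
sum<-snoc g (suc m) = trans (cong (g 0 +_) (sum<-snoc (g ∘ suc) m)) (sym (+-assoc (g 0) _ _))

sum<-cong : ∀ {g h} m → (∀ k → g k ≡ h k) → sum< g m ≡ sum< h m
sum<-cong zero    g≗h = refl
sum<-cong (suc m) g≗h = cong₂ _+_ (g≗h 0) (sum<-cong m (g≗h ∘ suc))

sum<-mono-≤ : ∀ {g h} m → (∀ k → g k ≤ h k) → sum< g m ≤ sum< h m
sum<-mono-≤ zero    g≤h = z≤n
sum<-mono-≤ (suc m) g≤h = +-mono-≤ (g≤h 0) (sum<-mono-≤ m (g≤h ∘ suc))

sum<-mono-≤-≡ : ∀ {g h} m → (∀ k → g k ≤ h k) → sum< g m ≡ sum< h m → ∀ k → k < m → g k ≡ h k
sum<-mono-≤-≡ {g} {h} (suc m) g≤h eq zero _ = ≤-antisym (g≤h 0) (+-cancelʳ-≤ (sum< (g ∘ suc) m) _ _ (begin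
  h 0 + sum< (g ∘ suc) m ≤⟨ +-monoʳ-≤ (h 0) (sum<-mono-≤ m (g≤h ∘ suc)) ⟩
  h 0 + sum< (h ∘ suc) m ≡⟨ sym eq ⟩
  g 0 + sum< (g ∘ suc) m ∎))
  where open ≤-Reasoning
sum<-mono-≤-≡ {g} {h} (suc m) g≤h eq (suc k) (s≤s k<m) =
  sum<-mono-≤-≡ m (g≤h ∘ suc) (+-cancelˡ-≡ (g 0) _ _ (trans eq (cong (_+ sum< (h ∘ suc) m) (sym g₀≡h₀)))) k k<m
  where g₀≡h₀ = sum<-mono-≤-≡ (suc m) g≤h eq zero z<s

sum<-rotate : ∀ ℓ g → (∀ k → g (k + ℓ) ≡ g k) → ∀ a → sum< (λ t → g (a + t)) ℓ ≡ sum< g ℓ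
sum<-rotate ℓ g periodic zero    = refl
sum<-rotate ℓ g periodic (suc a) = +-cancelˡ-≡ (g a) _ _ (begin
  g a + sum< (λ t → g (suc a + t)) ℓ
    ≡⟨ cong₂ _+_ (cong g (sym (+-identityʳ a))) (sum<-cong ℓ (λ k → cong g (sym (+-suc a k)))) ⟩
  sum< (λ t → g (a + t)) (suc ℓ)     ≡⟨ sum<-snoc (λ t → g (a + t)) ℓ ⟩
  sum< (λ t → g (a + t)) ℓ + g (a + ℓ) ≡⟨ cong₂ _+_ (sum<-rotate ℓ g periodic a) (periodic a) ⟩
  sum< g ℓ + g a                     ≡⟨ +-comm _ (g a) ⟩
  g a + sum< g ℓ                     ∎)
  where open ≡-Reasoning

Σ-toℕ : ∀ m (g : ℕ → ℕ) → Σ[ (λ (i : Fin m) → g (toℕ i)) ] ≡ sum< g m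
Σ-toℕ zero    g = refl
Σ-toℕ (suc m) g = trans (Σ-suc {m} (g ∘ toℕ)) (cong (g 0 +_) (Σ-toℕ m (g ∘ suc)))

Σ-sum<-comm : ∀ {n} m (f : Fin n → ℕ → ℕ) → Σ[ (λ j → sum< (f j) m) ] ≡ sum< (λ k → Σ[ (λ j → f j k) ]) m
Σ-sum<-comm {n} zero    f = Σ-zero {n} (λ _ → refl)
Σ-sum<-comm     (suc m) f = trans (Σ-distrib-+ (λ j → f j 0) (λ j → sum< (f j ∘ suc) m))
  (cong (Σ[ (λ j → f j 0) ] +_) (Σ-sum<-comm m (λ j → f j ∘ suc)))

sgn : ℕ → ℕ
sgn zero    = 0
sgn (suc _) = 1

sgn≤id : ∀ x → sgn x ≤ x
sgn≤id zero    = z≤n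
sgn≤id (suc x) = s≤s z≤n

sgn-cong : ∀ {x y} k → x ≤ y → y ≤ k * x → sgn x ≡ sgn y
sgn-cong {zero}  {zero}  k _   _   = refl
sgn-cong {zero}  {suc y} k _   y≤0 = contradiction (≤-trans y≤0 (≤-reflexive (*-zeroʳ k))) λ ()
sgn-cong {suc x} {zero}  k ()  _
sgn-cong {suc x} {suc y} k _   _   = refl

length-filter : ∀ {A : Set} {P : Pred A 0ℓ} (P? : Decidable P) (h : A → ℕ) →
  (∀ x → P x → 0 < h x) → (∀ x → 0 < h x → P x) → ∀ xs → length (filter P? xs) ≡ sum (map (sgn ∘ h) xs)
length-filter P? h P⇒h>0 h>0⇒P []       = refl
length-filter P? h P⇒h>0 h>0⇒P (x ∷ xs) with P? x | h x in hx
... | yes Px | zero  = ⊥-elim (<-irrefl refl (subst (0 <_) hx (P⇒h>0 x Px)))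
... | yes Px | suc _ = cong suc (length-filter P? h P⇒h>0 h>0⇒P xs)
... | no ¬Px | zero  = length-filter P? h P⇒h>0 h>0⇒P xs
... | no ¬Px | suc _ = ⊥-elim (¬Px (h>0⇒P x (subst (0 <_) (sym hx) z<s)))

-- horner p g m is the base-p numeral with digits g 0, …, g (m ∸ 1), most significant first.

horner : ℕ → (ℕ → ℕ) → ℕ → ℕ
horner p g zero    = 0
horner p g (suc m) = p * horner p g m + g m

horner-cong : ∀ p {g h} m → (∀ k → k < m → g k ≡ h k) → horner p g m ≡ horner p h m
horner-cong p zero    g≗h = refl
horner-cong p (suc m) g≗h =
  cong₂ _+_ (cong (p *_) (horner-cong p m (λ k k<m → g≗h k (m<n⇒m<1+n k<m)))) (g≗h m ≤-refl)

horner-mono-* : ∀ p A {f g} m → (∀ k → f k ≤ A * g k) → horner p f m ≤ A * horner p g m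
horner-mono-* p A         zero    f≤Ag = z≤n
horner-mono-* p A {f} {g} (suc m) f≤Ag = begin
  p * horner p f m + f m       ≤⟨ +-mono-≤ (*-monoʳ-≤ p (horner-mono-* p A m f≤Ag)) (f≤Ag m) ⟩
  p * (A * horner p g m) + A * g m ≡⟨ pull-A p A (horner p g m) (g m) ⟩
  A * (p * horner p g m + g m) ∎
  where
  open ≤-Reasoning
  pull-A : ∀ p A h d → p * (A * h) + A * d ≡ A * (p * h + d)
  pull-A = solve-∀

horner-telescope : ∀ p K (f g : ℕ → ℕ) → (∀ k → p * f k ≡ f (suc k) + K * g k) →
  ∀ m → p ^ m * f 0 ≡ f m + K * horner p g m
horner-telescope p K f g step zero =
  trans (*-identityˡ (f 0)) (sym (trans (cong (f 0 +_) (*-zeroʳ K)) (+-identityʳ (f 0))))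
horner-telescope p K f g step (suc m) = begin
  p * p ^ m * f 0                     ≡⟨ *-assoc p (p ^ m) (f 0) ⟩
  p * (p ^ m * f 0)                   ≡⟨ cong (p *_) (horner-telescope p K f g step m) ⟩
  p * (f m + K * horner p g m)        ≡⟨ distrib p (f m) K (horner p g m) ⟩
  p * f m + K * (p * horner p g m)    ≡⟨ cong (_+ K * (p * horner p g m)) (step m) ⟩
  f (suc m) + K * g m + K * (p * horner p g m) ≡⟨ collect (f (suc m)) K (g m) p (horner p g m) ⟩
  f (suc m) + K * (p * horner p g m + g m) ∎
  where
  open ≡-Reasoning
  distrib : ∀ p a K h → p * (a + K * h) ≡ p * a + K * (p * h)
  distrib = solve-∀
  collect : ∀ a K d p h → a + K * d + K * (p * h) ≡ a + K * (p * h + d)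
  collect = solve-∀

1+horner-const : ∀ q m → suc (horner (suc q) (const q) m) ≡ suc q ^ m
1+horner-const q zero    = refl
1+horner-const q (suc m) = trans (factor q (horner (suc q) (const q) m))
                                 (cong (suc q *_) (1+horner-const q m))
  where
  factor : ∀ q h → suc (suc q * h + q) ≡ suc q * suc h
  factor = solve-∀

digitSumAux-0 : ∀ r f → digitSumAux (2 + r) f 0 ≡ 0
digitSumAux-0 r zero    = refl
digitSumAux-0 r (suc f) = digitSumAux-0 r f

digitSumAux-fuel : ∀ r {f f′} x → x ≤ f → x ≤ f′ → digitSumAux (2 + r) f x ≡ digitSumAux (2 + r) f′ x
digitSumAux-fuel r {f} {f′} zero _ _ = trans (digitSumAux-0 r f) (sym (digitSumAux-0 r f′))
digitSumAux-fuel r {suc f} {suc f′} (suc x) (s≤s x≤f) (s≤s x≤f′) =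
  cong (suc x % (2 + r) +_) (digitSumAux-fuel r (suc x / (2 + r)) (≤-trans quot≤x x≤f) (≤-trans quot≤x x≤f′))
  where quot≤x = <⇒≤pred (m/n<m (suc x) (2 + r) (s≤s (s≤s z≤n)))

digitSum-unfold : ∀ r x → digitSum (2 + r) x ≡ x % (2 + r) + digitSum (2 + r) (x / (2 + r))
digitSum-unfold r zero    = refl
digitSum-unfold r (suc x) =
  cong (suc x % (2 + r) +_) (digitSumAux-fuel r (suc x / (2 + r)) quot≤x ≤-refl)
  where quot≤x = <⇒≤pred (m/n<m (suc x) (2 + r) (s≤s (s≤s z≤n)))

digitSum-horner : ∀ r c m → (∀ k → c k < 2 + r) → digitSum (2 + r) (horner (2 + r) c m) ≡ sum< c m
digitSum-horner r c zero    c<p = refl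
digitSum-horner r c (suc m) c<p = begin
  digitSum p (p * H + c m)                          ≡⟨ digitSum-unfold r (p * H + c m) ⟩
  (p * H + c m) % p + digitSum p ((p * H + c m) / p) ≡⟨ cong₂ (λ a b → a + digitSum p b) last-digit rest ⟩
  c m + digitSum p H                                ≡⟨ cong (c m +_) (digitSum-horner r c m c<p) ⟩
  c m + sum< c m                                    ≡⟨ +-comm (c m) (sum< c m) ⟩
  sum< c m + c m                                    ≡⟨ sym (sum<-snoc c m) ⟩
  sum< c (suc m)                                    ∎
  where
  open ≡-Reasoning
  p = 2 + r
  H = horner p c m
  split = %-/-unique (p * H + c m) p {c m} {H} (c<p m) (+-comm (p * H) (c m))
  last-digit = proj₁ split
  rest = proj₂ split

-- Writing p = suc q, and R = horner p (const q) m = p ^ m ∸ 1, horner-digit-bound says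
-- (p ∸ 1) · value ≤ (digit sum − number of nonzero digits + 1) · (p ^ m ∸ 1), rearranged to avoid ∸.

horner-digit-bound-step : ∀ q H c t R G → q * H + c * R ≤ (t + 1) * R → c ≤ t →
  q * (suc q * H + G) + (c + sgn G) * (suc q * R + q) ≤ (t + G + 1) * (suc q * R + q)
horner-digit-bound-step q H c t R zero ih c≤t = begin
  q * (p * H + 0) + (c + 0) * (p * R + q) ≡⟨ regroup q H c R ⟩
  p * (q * H + c * R) + c * q           ≤⟨ +-mono-≤ (*-monoʳ-≤ p ih) (*-monoˡ-≤ q (≤-trans c≤t (m≤m+n t 1))) ⟩
  p * ((t + 1) * R) + (t + 1) * q       ≡⟨ collect q t R ⟩
  (t + 0 + 1) * (p * R + q)             ∎
  where
  open ≤-Reasoning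
  p = suc q
  regroup : ∀ q H c R → q * (suc q * H + 0) + (c + 0) * (suc q * R + q) ≡ suc q * (q * H + c * R) + c * q
  regroup = solve-∀
  collect : ∀ q t R → suc q * ((t + 1) * R) + (t + 1) * q ≡ (t + 0 + 1) * (suc q * R + q)
  collect = solve-∀
horner-digit-bound-step q H c t R (suc G) ih c≤t = begin
  q * (p * H + suc G) + (c + 1) * (p * R + q)               ≡⟨ regroup q H G c R ⟩
  p * (q * H + c * R) + (c * q + (q * suc G + q + p * R))   ≤⟨ +-mono-≤ (*-monoʳ-≤ p ih)
                                                                (+-mono-≤ (*-monoˡ-≤ q c≤t) (m≤m+n _ (G * (p * R)))) ⟩
  p * ((t + 1) * R) + (t * q + (q * suc G + q + p * R + G * (p * R))) ≡⟨ collect q G t R ⟩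
  (t + suc G + 1) * (p * R + q)                             ∎
  where
  open ≤-Reasoning
  p = suc q
  regroup : ∀ q H G c R → q * (suc q * H + suc G) + (c + 1) * (suc q * R + q)
                        ≡ suc q * (q * H + c * R) + (c * q + (q * suc G + q + suc q * R))
  regroup = solve-∀
  collect : ∀ q G t R → suc q * ((t + 1) * R) + (t * q + (q * suc G + q + suc q * R + G * (suc q * R)))
                      ≡ (t + suc G + 1) * (suc q * R + q)
  collect = solve-∀

horner-digit-bound : ∀ q g m →
  q * horner (suc q) g m + sum< (sgn ∘ g) m * horner (suc q) (const q) m
    ≤ (sum< g m + 1) * horner (suc q) (const q) m
horner-digit-bound q g zero    = ≤-reflexive (trans (+-identityʳ (q * 0)) (*-zeroʳ q))
horner-digit-bound q g (suc m) = begin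
  q * horner p g (suc m) + sum< (sgn ∘ g) (suc m) * R′ ≡⟨ cong (λ c → q * horner p g (suc m) + c * R′) (sum<-snoc (sgn ∘ g) m) ⟩
  q * (p * horner p g m + g m) + (sum< (sgn ∘ g) m + sgn (g m)) * R′
    ≤⟨ horner-digit-bound-step q _ _ _ _ (g m) (horner-digit-bound q g m) (sum<-mono-≤ m (sgn≤id ∘ g)) ⟩
  (sum< g m + g m + 1) * R′                            ≡⟨ cong (λ t → (t + 1) * R′) (sym (sum<-snoc g m)) ⟩
  (sum< g (suc m) + 1) * R′                            ∎
  where
  open ≤-Reasoning
  p = suc q
  R′ = horner p (const q) (suc m)

transfer-bound : ∀ {q F K H A w s} → 0 < K → K * F ≤ A * H → q * H + s * K ≤ (w + 1) * K →
  q * F ≤ (w + 1 ∸ s) * A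
transfer-bound {q} {F} {suc K} {H} {A} {w} {s} _ KF≤AH bound = *-cancelʳ-≤ (q * F) ((w + 1 ∸ s) * A) (suc K) (begin
  q * F * suc K          ≡⟨ swap₁ q F (suc K) ⟩
  q * (suc K * F)        ≤⟨ *-monoʳ-≤ q KF≤AH ⟩
  q * (A * H)            ≡⟨ swap₂ q A H ⟩
  A * (q * H)            ≤⟨ *-monoʳ-≤ A qH≤ ⟩
  A * ((w + 1 ∸ s) * suc K) ≡⟨ swap₃ A (w + 1 ∸ s) (suc K) ⟩
  (w + 1 ∸ s) * A * suc K ∎)
  where
  open ≤-Reasoning
  swap₁ : ∀ a b c → a * b * c ≡ a * (c * b)
  swap₁ = solve-∀
  swap₂ : ∀ a b c → a * (b * c) ≡ b * (a * c)
  swap₂ = solve-∀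
  swap₃ : ∀ a b c → a * (b * c) ≡ b * a * c
  swap₃ = solve-∀
  qH≤ : q * H ≤ (w + 1 ∸ s) * suc K
  qH≤ = subst (q * H ≤_) (sym (*-distribʳ-∸ (suc K) (w + 1) s)) (m+n≤o⇒m≤o∸n (q * H) bound)

toℕ-next : ∀ {ℓ} (i : Fin ℓ) → toℕ (next i) ≡ suc (toℕ i) ⊎ (suc (toℕ i) ≡ ℓ × toℕ (next i) ≡ 0)
toℕ-next {suc zero}    zero = inj₂ (refl , refl)
toℕ-next {suc (suc m)} zero = inj₁ refl
toℕ-next {suc (suc m)} (suc i) with next {suc m} i | toℕ-next {suc m} i
... | zero  | inj₁ ()
... | zero  | inj₂ (i+1≡ , _) = inj₂ (cong suc i+1≡ , refl)
... | suc j | inj₁ j≡        = inj₁ (cong suc j≡)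
... | suc j | inj₂ (_ , ())

-- For x < p ^ ℓ ∸ 1, viewed as an ℓ-digit base-p numeral, shift rotates the digits one place
-- to the left and carry is the digit that wraps around: p · x = shift x + (p ^ ℓ ∸ 1) · carry x.

carry : (p ℓ x : ℕ) → ℕ
carry p ℓ x with x ≟ Mod p ℓ
... | yes _ = p ∸ 1
... | no  _ = divℕ (p * x) (Mod p ℓ)

module Cyclic (r ℓ : ℕ) (ℓ≥1 : 1 ≤ ℓ) where

  p M : ℕ
  p = 2 + r
  M = Mod p ℓ

  M≡horner : M ≡ horner p (const (1 + r)) ℓ
  M≡horner = cong (_∸ 1) (sym (1+horner-const (1 + r) ℓ))

  p^ℓ≡1+M : p ^ ℓ ≡ suc M
  p^ℓ≡1+M = trans (sym (1+horner-const (1 + r) ℓ)) (cong suc (sym M≡horner))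

  M>0 : 0 < M
  M>0 = subst (0 <_) (sym M≡horner) (horner-const>0 ℓ ℓ≥1)
    where
    horner-const>0 : ∀ m → 1 ≤ m → 0 < horner p (const (1 + r)) m
    horner-const>0 (suc m) _ = ≤-trans z<s (m≤n+m (1 + r) (p * horner p (const (1 + r)) m))

  instance
    M-nonZero : NonZero M
    M-nonZero = >-nonZero M>0

  shift-carry : ∀ x → x ≤ M → p * x ≡ shift p ℓ x + M * carry p ℓ x
  shift-carry x x≤M with x ≟ Mod p ℓ
  ... | yes refl = split-p r x
    where
    split-p : ∀ r x → (2 + r) * x ≡ x + x * (1 + r)
    split-p = solve-∀
  ... | no _ = begin
    p * x                             ≡⟨ m≡m%n+[m/n]*n (p * x) M ⟩
    p * x % M + p * x / M * M         ≡⟨ cong₂ _+_ (sym (modℕ≡% (p * x) M)) (*-comm (p * x / M) M) ⟩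
    modℕ (p * x) M + M * (p * x / M)  ≡⟨ cong (λ c → modℕ (p * x) M + M * c) (sym (divℕ≡/ (p * x) M)) ⟩
    modℕ (p * x) M + M * divℕ (p * x) M ∎
    where open ≡-Reasoning

  carry<p : ∀ x → x ≤ M → carry p ℓ x < p
  carry<p x x≤M with x ≟ Mod p ℓ
  ... | yes _   = ≤-refl
  ... | no x≢M = subst (_< p) (sym (divℕ≡/ (p * x) M)) (m<n*o⇒m/o<n (*-monoʳ-< p (≤∧≢⇒< x≤M x≢M)))

  shift-< : ∀ x → x < M → shift p ℓ x < M
  shift-< x x<M with x ≟ Mod p ℓ
  ... | yes x≡M = contradiction x≡M (<⇒≢ x<M)
  ... | no  _   = subst (_< M) (sym (modℕ≡% (p * x) M)) (m%n<n (p * x) M)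

  shift-M : shift p ℓ M ≡ M
  shift-M with Mod p ℓ ≟ Mod p ℓ
  ... | yes _   = refl
  ... | no M≢M = contradiction refl M≢M

  orbit digits : ℕ → ℕ → ℕ
  orbit u k  = iter k (shift p ℓ) u
  digits u k = carry p ℓ (orbit u k)

  orbit-≤ : ∀ {u} → u ≤ M → ∀ k → orbit u k ≤ M
  orbit-≤ u≤M zero    = u≤M
  orbit-≤ {u} u≤M (suc k) with m≤n⇒m<n∨m≡n (orbit-≤ u≤M k)
  ... | inj₁ x<M = <⇒≤ (shift-< (orbit u k) x<M)
  ... | inj₂ x≡M = ≤-reflexive (trans (cong (shift p ℓ) x≡M) shift-M)

  orbit-step : ∀ {u} → u ≤ M → ∀ k → p * orbit u k ≡ orbit u (suc k) + M * digits u k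
  orbit-step {u} u≤M k = shift-carry (orbit u k) (orbit-≤ u≤M k)

  digits<p : ∀ {u} → u ≤ M → ∀ k → digits u k < p
  digits<p {u} u≤M k = carry<p (orbit u k) (orbit-≤ u≤M k)

  orbit-telescope : ∀ {u} → u ≤ M → ∀ m → p ^ m * u ≡ orbit u m + M * horner p (digits u) m
  orbit-telescope {u} u≤M = horner-telescope p M (orbit u) (digits u) (orbit-step u≤M)

  orbit-period : ∀ {u} → u ≤ M → orbit u ℓ ≡ u
  orbit-period {u} u≤M with m≤n⇒m<n∨m≡n u≤M
  ... | inj₁ u<M = proj₁ (remainder-quotient-unique M (orbit-< ℓ) u<M
                          (trans (sym (orbit-telescope u≤M ℓ)) (cong (_* u) p^ℓ≡1+M)))
    where
    orbit-< : ∀ k → orbit u k < M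
    orbit-< zero    = u<M
    orbit-< (suc k) = shift-< (orbit u k) (orbit-< k)
  ... | inj₂ refl = orbit-M ℓ
    where
    orbit-M : ∀ k → orbit M k ≡ M
    orbit-M zero    = refl
    orbit-M (suc k) = trans (cong (shift p ℓ) (orbit-M k)) shift-M

  orbit-periodic : ∀ {u} → u ≤ M → ∀ k → orbit u (k + ℓ) ≡ orbit u k
  orbit-periodic {u} u≤M k = trans (iter-+ k ℓ (shift p ℓ) u) (cong (iter k (shift p ℓ)) (orbit-period u≤M))

  horner-digits : ∀ {u} → u ≤ M → horner p (digits u) ℓ ≡ u
  horner-digits {u} u≤M = *-cancelˡ-≡ _ _ M (+-cancelˡ-≡ u _ _ (begin
    u + M * horner p (digits u) ℓ          ≡⟨ cong (_+ M * horner p (digits u) ℓ) (sym (orbit-period u≤M)) ⟩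
    orbit u ℓ + M * horner p (digits u) ℓ  ≡⟨ sym (orbit-telescope u≤M ℓ) ⟩
    p ^ ℓ * u                              ≡⟨ cong (_* u) p^ℓ≡1+M ⟩
    u + M * u                              ∎))
    where open ≡-Reasoning

  digitSum-digits : ∀ {u} → u ≤ M → digitSum p u ≡ sum< (digits u) ℓ
  digitSum-digits {u} u≤M = trans (cong (digitSum p) (sym (horner-digits u≤M)))
                                  (digitSum-horner r (digits u) ℓ (digits<p u≤M))

module Solution (r ℓ : ℕ) {n : ℕ} (D : Fin n → ℕ) (D>0 : ∀ j → 0 < D j) (U : Fin n → ℕ)
                (sol : IsSolution (2 + r) D ℓ U) where

  open Cyclic r ℓ (proj₁ sol)

  U≤M : ∀ j → U j ≤ M
  U≤M = proj₁ (proj₂ sol)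

  c : Fin n → ℕ → ℕ
  c j = digits (U j)

  S C W Φ : ℕ → ℕ
  S k = Σ[ (λ j → D j * orbit (U j) k) ]
  C k = Σ[ (λ j → D j * c j k) ]
  W k = Σ[ (λ j → c j k) ]
  Φ k = divℕ (S k) M

  S-step : ∀ k → p * S k ≡ S (suc k) + M * C k
  S-step k = begin
    p * S k                                           ≡⟨ *-distribˡ-Σ p (λ j → D j * orbit (U j) k) ⟩
    Σ[ (λ j → p * (D j * orbit (U j) k)) ]            ≡⟨ Σ-cong coordinate-step ⟩
    Σ[ (λ j → D j * orbit (U j) (suc k) + M * (D j * c j k)) ]
                                                      ≡⟨ Σ-distrib-+ (λ j → D j * orbit (U j) (suc k)) _ ⟩
    S (suc k) + Σ[ (λ j → M * (D j * c j k)) ]        ≡⟨ cong (S (suc k) +_) (sym (*-distribˡ-Σ M (λ j → D j * c j k))) ⟩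
    S (suc k) + M * C k                               ∎
    where
    open ≡-Reasoning
    swap : ∀ a b c → a * (b * c) ≡ b * (a * c)
    swap = solve-∀
    distrib : ∀ d y M e → d * (y + M * e) ≡ d * y + M * (d * e)
    distrib = solve-∀
    rearrange : ∀ p d y y′ M e → p * y ≡ y′ + M * e → p * (d * y) ≡ d * y′ + M * (d * e)
    rearrange p d y y′ M e eq = trans (swap p d y) (trans (cong (d *_) eq) (distrib d y′ M e))
    coordinate-step : ∀ j → p * (D j * orbit (U j) k) ≡ D j * orbit (U j) (suc k) + M * (D j * c j k)
    coordinate-step j = rearrange p (D j) _ _ M _ (orbit-step (U≤M j) k)

  M∣S : ∀ k → M ∣ S k
  M∣S zero    = proj₁ (proj₂ (proj₂ sol))
  M∣S (suc k) = ∣m+n∣m⇒∣n (subst (M ∣_) (trans (S-step k) (+-comm (S (suc k)) (M * C k))) (∣n⇒∣m*n p (M∣S k)))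
                          (m∣m*n (C k))

  S≡M*Φ : ∀ k → S k ≡ M * Φ k
  S≡M*Φ k = sym (trans (cong (M *_) (divℕ≡/ (S k) M)) (m*[n/m]≡n (M∣S k)))

  Φ-step : ∀ k → p * Φ k ≡ Φ (suc k) + C k
  Φ-step k = *-cancelˡ-≡ _ _ M (begin
    M * (p * Φ k)             ≡⟨ swap M p (Φ k) ⟩
    p * (M * Φ k)             ≡⟨ cong (p *_) (sym (S≡M*Φ k)) ⟩
    p * S k                   ≡⟨ S-step k ⟩
    S (suc k) + M * C k       ≡⟨ cong (_+ M * C k) (S≡M*Φ (suc k)) ⟩
    M * Φ (suc k) + M * C k   ≡⟨ sym (*-distribˡ-+ M (Φ (suc k)) (C k)) ⟩
    M * (Φ (suc k) + C k)     ∎)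
    where
    open ≡-Reasoning
    swap : ∀ a b c → a * (b * c) ≡ b * (a * c)
    swap = solve-∀

  c-periodic : ∀ j k → c j (k + ℓ) ≡ c j k
  c-periodic j k = cong (carry p ℓ) (orbit-periodic (U≤M j) k)

  W-periodic : ∀ k → W (k + ℓ) ≡ W k
  W-periodic k = Σ-cong (λ j → c-periodic j k)

  Φ-periodic : ∀ k → Φ (k + ℓ) ≡ Φ k
  Φ-periodic k = cong (λ s → divℕ s M) (Σ-cong (λ j → cong (D j *_) (orbit-periodic (U≤M j) k)))

  Φ>0 : ∀ k → k ≤ ℓ → 0 < Φ k
  Φ>0 k k≤ℓ with Φ k in Φk
  ... | suc _ = z<s
  ... | zero  = contradiction S₀≡0 (>⇒≢ (proj₂ (proj₂ (proj₂ sol))))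
    where
    Φ-stays-0 : ∀ t → Φ (t + k) ≡ 0
    Φ-stays-0 zero    = Φk
    Φ-stays-0 (suc t) = m+n≡0⇒m≡0 _ (trans (sym (Φ-step (t + k))) (trans (cong (p *_) (Φ-stays-0 t)) (*-zeroʳ p)))
    S₀≡0 : S 0 ≡ 0
    S₀≡0 = begin
      S 0        ≡⟨ S≡M*Φ 0 ⟩
      M * Φ 0    ≡⟨ cong (M *_) (sym (Φ-periodic 0)) ⟩
      M * Φ ℓ    ≡⟨ cong (λ t → M * Φ t) (sym (m∸n+n≡m k≤ℓ)) ⟩
      M * Φ (ℓ ∸ k + k) ≡⟨ cong (M *_) (Φ-stays-0 (ℓ ∸ k)) ⟩
      M * 0      ≡⟨ *-zeroʳ M ⟩
      0          ∎
      where open ≡-Reasoning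

  sup : Fin ℓ → ℕ
  sup = support p D ℓ U

  sup-step : ∀ i → p * sup i ≡ sup (next i) + C (toℕ i)
  sup-step i = trans (Φ-step (toℕ i)) (cong (_+ C (toℕ i)) (sym sup-next))
    where
    sup-next : sup (next i) ≡ Φ (suc (toℕ i))
    sup-next with toℕ-next i
    ... | inj₁ next≡ = cong Φ next≡
    ... | inj₂ (i+1≡ℓ , next≡0) = trans (cong Φ next≡0) (trans (sym (Φ-periodic 0)) (cong Φ (sym i+1≡ℓ)))

  jumpAt≡C : ∀ i → jumpAt p sup i ≡ C (toℕ i)
  jumpAt≡C i = trans (cong (_∸ sup (next i)) (sup-step i)) (m+n∸m≡n (sup (next i)) (C (toℕ i)))

  C>0⇒jump : ∀ i → 0 < C (toℕ i) → sup (next i) < p * sup i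
  C>0⇒jump i C>0 = subst (sup (next i) <_) (sym (sup-step i)) (m<m+n (sup (next i)) C>0)

  jump⇒C>0 : ∀ i → sup (next i) < p * sup i → 0 < C (toℕ i)
  jump⇒C>0 i jump with C (toℕ i) in Ci
  ... | suc _ = z<s
  ... | zero  = contradiction (trans (sup-step i) (trans (cong (sup (next i) +_) Ci) (+-identityʳ _))) (>⇒≢ jump)

  sgn∘W≡sgn∘C : ∀ k → sgn (W k) ≡ sgn (C k)
  sgn∘W≡sgn∘C k = sgn-cong (maxF D) (Σ≤Σ-weighted D (λ j → c j k) D>0) (Σ-weighted≤max D (λ j → c j k))

  number-of-jumps : length (jumpPositions p sup) ≡ sum< (sgn ∘ W) ℓ
  number-of-jumps = begin
    length (jumpPositions p sup)    ≡⟨ length-filter (λ i → sup (next i) <? p * sup i) (C ∘ toℕ) jump⇒C>0 C>0⇒jump (allFin ℓ) ⟩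
    Σ[ (λ (i : Fin ℓ) → sgn (C (toℕ i))) ] ≡⟨ Σ-toℕ ℓ (sgn ∘ C) ⟩
    sum< (sgn ∘ C) ℓ                ≡⟨ sum<-cong ℓ (sym ∘ sgn∘W≡sgn∘C) ⟩
    sum< (sgn ∘ W) ℓ                ∎
    where open ≡-Reasoning

  weight≡ : weight p U ≡ sum< W ℓ
  weight≡ = trans (Σ-cong (λ j → digitSum-digits (U≤M j))) (Σ-sum<-comm ℓ c)

  isSupportMap : IsSupportMap p sup (sum< (sgn ∘ W) ℓ)
  isSupportMap = (λ i → Φ>0 (toℕ i) (<⇒≤ (toℕ<n i))) , step-or-jump , number-of-jumps
    where
    step-or-jump : ∀ i → sup (next i) ≡ p * sup i ⊎ sup (next i) < p * sup i
    step-or-jump i with C (toℕ i) in Ci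
    ... | zero  = inj₁ (sym (trans (sup-step i) (trans (cong (sup (next i) +_) Ci) (+-identityʳ _))))
    ... | suc _ = inj₂ (C>0⇒jump i (subst (0 <_) (sym Ci) z<s))

  U≡horner : ∀ j → U j ≡ horner p (c j) ℓ
  U≡horner j = sym (horner-digits (U≤M j))

  weight-bound : ∃ λ s → s ≤ weight p U × IsSupportMap p sup s
  weight-bound = sum< (sgn ∘ W) ℓ , subst (sum< (sgn ∘ W) ℓ ≤_) (sym weight≡) (sum<-mono-≤ ℓ (sgn≤id ∘ W)) ,
                 isSupportMap

  jumps≡ : ∀ {s} → IsSupportMap p sup s → s ≡ sum< (sgn ∘ W) ℓ
  jumps≡ (_ , _ , length≡s) = trans (sym length≡s) number-of-jumps

  M*Φ≡horner : ∀ a → M * Φ a ≡ horner p (λ t → C (a + t)) ℓ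
  M*Φ≡horner a = +-cancelˡ-≡ (Φ a) _ _ (begin
    Φ a + M * Φ a            ≡⟨ cong (_* Φ a) (sym p^ℓ≡1+M) ⟩
    p ^ ℓ * Φ a              ≡⟨ cong (λ t → p ^ ℓ * Φ t) (sym (+-identityʳ a)) ⟩
    p ^ ℓ * Φ (a + 0)        ≡⟨ horner-telescope p 1 (λ t → Φ (a + t)) (λ t → C (a + t)) step ℓ ⟩
    Φ (a + ℓ) + 1 * HC       ≡⟨ cong₂ _+_ (Φ-periodic a) (*-identityˡ HC) ⟩
    Φ a + HC                 ∎)
    where
    open ≡-Reasoning
    HC = horner p (λ t → C (a + t)) ℓ
    step : ∀ k → p * Φ (a + k) ≡ Φ (a + suc k) + 1 * C (a + k)
    step k = trans (Φ-step (a + k)) (cong₂ _+_ (cong Φ (sym (+-suc a k))) (sym (*-identityˡ (C (a + k)))))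

  rotated-digit-bound : ∀ a → (1 + r) * horner p (λ t → W (a + t)) ℓ + sum< (sgn ∘ W) ℓ * M ≤ (sum< W ℓ + 1) * M
  rotated-digit-bound a = subst₂ (λ s w → (1 + r) * horner p Wₐ ℓ + s * M ≤ (w + 1) * M)
    (sum<-rotate ℓ (sgn ∘ W) (cong sgn ∘ W-periodic) a) (sum<-rotate ℓ W W-periodic a)
    (subst (λ R → (1 + r) * horner p Wₐ ℓ + sum< (sgn ∘ Wₐ) ℓ * R ≤ (sum< Wₐ ℓ + 1) * R) (sym M≡horner)
           (horner-digit-bound (1 + r) Wₐ ℓ))
    where Wₐ = λ t → W (a + t)

  support-bound : ∀ s → IsSupportMap p sup s → ∀ i → (p ∸ 1) * sup i ≤ (weight p U + 1 ∸ s) * maxF D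
  support-bound s isMap i = transfer-bound {q = 1 + r} {H = horner p Wₐ ℓ} {w = weight p U} {s = s} M>0
    (≤-trans (≤-reflexive (M*Φ≡horner a)) (horner-mono-* p (maxF D) ℓ (λ k → Σ-weighted≤max D (λ j → c j (a + k)))))
    (subst₂ (λ s w → (1 + r) * horner p Wₐ ℓ + s * M ≤ (w + 1) * M)
            (sym (jumps≡ isMap)) (sym weight≡) (rotated-digit-bound a))
    where
    a = toℕ i
    Wₐ = λ t → W (a + t)

  module AllJumpsCounted (isMap : IsSupportMap p sup (weight p U)) where

    W≤1 : ∀ k → k < ℓ → W k ≤ 1
    W≤1 k k<ℓ = subst (_≤ 1) (sum<-mono-≤-≡ ℓ (sgn≤id ∘ W) sgn∘W≡W k k<ℓ) (sgn≤1 (W k))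
      where
      sgn∘W≡W : sum< (sgn ∘ W) ℓ ≡ sum< W ℓ
      sgn∘W≡W = trans (sym (jumps≡ isMap)) weight≡
      sgn≤1 : ∀ x → sgn x ≤ 1
      sgn≤1 zero    = z≤n
      sgn≤1 (suc _) = ≤-refl

    jump∈D : ∀ i → sup (next i) < p * sup i → ∃ λ j → D j ≡ jumpAt p sup i
    jump∈D i jump with Σ≤1⇒weighted-Σ≡weight D (λ j → c j (toℕ i)) (W≤1 (toℕ i) (toℕ<n i)) (jump⇒C>0 i jump)
    ... | j , C≡Dj = j , sym (trans (jumpAt≡C i) C≡Dj)

solution-determined-by-support : ∀ r ℓ {n} (D : Fin n → ℕ) → Injective _≡_ _≡_ D → (∀ j → 0 < D j) →
  ∀ {U V} → IsSolution (2 + r) D ℓ U → IsSolution (2 + r) D ℓ V →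
  (∀ i → support (2 + r) D ℓ V i ≡ support (2 + r) D ℓ U i) →
  IsSupportMap (2 + r) (support (2 + r) D ℓ U) (weight (2 + r) U) →
  IsSupportMap (2 + r) (support (2 + r) D ℓ V) (weight (2 + r) V) →
  ∀ j → V j ≡ U j
solution-determined-by-support r ℓ D D-inj D>0 {U} {V} solU solV same isMapU isMapV j = begin
  V j                  ≡⟨ SV.U≡horner j ⟩
  horner p (SV.c j) ℓ  ≡⟨ horner-cong p ℓ (λ k k<ℓ → digits-agree k k<ℓ j) ⟩
  horner p (SU.c j) ℓ  ≡⟨ sym (SU.U≡horner j) ⟩
  U j                  ∎
  where
  open ≡-Reasoning
  p = 2 + r
  module SU = Solution r ℓ D D>0 U solU
  module SV = Solution r ℓ D D>0 V solV
  C-agree : ∀ i → SV.C (toℕ i) ≡ SU.C (toℕ i)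
  C-agree i = +-cancelˡ-≡ (SU.sup (next i)) _ _ (begin
    SU.sup (next i) + SV.C (toℕ i) ≡⟨ cong (_+ SV.C (toℕ i)) (sym (same (next i))) ⟩
    SV.sup (next i) + SV.C (toℕ i) ≡⟨ sym (SV.sup-step i) ⟩
    p * SV.sup i                   ≡⟨ cong (p *_) (same i) ⟩
    p * SU.sup i                   ≡⟨ SU.sup-step i ⟩
    SU.sup (next i) + SU.C (toℕ i) ∎)
  digits-agree : ∀ k → k < ℓ → ∀ j → SV.c j k ≡ SU.c j k
  digits-agree k k<ℓ = weighted-Σ-injective D D-inj D>0
    (SV.AllJumpsCounted.W≤1 isMapV k k<ℓ) (SU.AllJumpsCounted.W≤1 isMapU k k<ℓ)
    (subst (λ t → SV.C t ≡ SU.C t) (toℕ-fromℕ< k<ℓ) (C-agree (fromℕ< k<ℓ)))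

proposition1p11 :
    (p : ℕ) → Prime p →
    (n : ℕ) (D : Fin n → ℕ) → Injective _≡_ _≡_ D → (∀ j → 0 < D j) →
    (ℓ : ℕ) (U : Fin n → ℕ) → IsSolution p D ℓ U →
    -- (i)
    (∃ λ s → s ≤ weight p U × IsSupportMap p (support p D ℓ U) s)
    × (IrreducibleMap (support p D ℓ U) ⇔ IrreducibleSol p D ℓ U)
    -- (ii)
    × (∀ s → IsSupportMap p (support p D ℓ U) s →
         ∀ i → (p ∸ 1) * support p D ℓ U i ≤ (weight p U + 1 ∸ s) * maxF D)
    -- (iii)
    × (IsSupportMap p (support p D ℓ U) (weight p U) →
         (∀ i → support p D ℓ U (Defs.next i) < p * support p D ℓ U i →
            ∃ λ j → D j ≡ jumpAt p (support p D ℓ U) i)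
         × (∀ (V : Fin n → ℕ) → IsSolution p D ℓ V →
              (∀ i → support p D ℓ V i ≡ support p D ℓ U i) →
              IsSupportMap p (support p D ℓ V) (weight p V) →
              ∀ j → V j ≡ U j))
proposition1p11 0 ()
proposition1p11 1 ()
proposition1p11 (suc (suc r)) _ n D D-inj D>0 ℓ U sol =
  weight-bound , mk⇔ id id , support-bound ,
  λ isMap → AllJumpsCounted.jump∈D isMap ,
            λ V solV same isMapV → solution-determined-by-support r ℓ D D-inj D>0 sol solV same isMap isMapV
  where open Solution r ℓ D D>0 U sol
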